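{- Let $R$ be an integral domain with $1$, let $d\ge0$ and let $p(t)=a_0+a_1t+\cdots+a_dt^d\in R[t]$ have degree $d$ with $a_0\neq0$. Let $V_{p(t)}$ be the $(d+1)\times(d+1)$ circulant matrix whose $i$-th row ($i=0,\dots,d$) is $T^i(a_d,a_{d-1},\dots,a_0)$, where $T(x_d,x_{d-1},\dots,x_1,x_0)=(x_0,x_d,\dots,x_1)$. Then the columns of the Riordan array $\bigl(1/(1-t^{d+1}),\,tp(t)\bigr)$ contain the complete forward orbit of the vector $(a_0,a_1,\dots,a_d)^T$ under the iterations of $V_{p(t)}$: for every $n\ge0$, the vector $V_{p(t)}^n(a_0,\dots,a_d)^T$ appears as a block of $d+1$ consecutive entries of some column of the array.
   Context: The Riordan array $\bigl(1/(1-t^{d+1}),\,tp(t)\bigr)$ is the infinite lower triangular matrix whose $k$-th column ($k\ge0$) consists of the coefficients of the power series $(tp(t))^k/(1-t^{d+1})$. -}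

module Defs where

open import Level using (_⊔_)
open import Algebra.Bundles using (CommutativeRing)
open import Data.Nat using (ℕ; zero; suc; _∸_; _≤?_; _≟_; _%_; s≤s)
open import Data.Fin using (Fin; zero; suc; fromℕ; fromℕ<; inject₁; toℕ; opposite)
open import Data.Sum using (_⊎_)
open import Data.Empty using (⊥)
open import Relation.Nullary using (¬_; yes; no)

record IsIntegralDomain {c ℓ} (R : CommutativeRing c ℓ) : Set (c ⊔ ℓ) where
  open CommutativeRing R using (Carrier; _≈_; _*_; 0#; 1#)
  field
    1≉0           : ¬ (1# ≈ 0#)
    noZeroDivisor : ∀ x y → x * y ≈ 0# → (x ≈ 0#) ⊎ (y ≈ 0#)

module _ {c ℓ} (R : CommutativeRing c ℓ) where
  open CommutativeRing R using (Carrier; _+_; _*_; 0#; 1#)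

  sumℕ : ℕ → (ℕ → Carrier) → Carrier
  sumℕ zero    f = 0#
  sumℕ (suc n) f = sumℕ n f + f n

  sumFin : ∀ {n} → (Fin n → Carrier) → Carrier
  sumFin {zero}  f = 0#
  sumFin {suc n} f = f zero + sumFin (λ j → f (suc j))

  Series : Set c
  Series = ℕ → Carrier

  _⊛_ : Series → Series → Series
  (f ⊛ g) n = sumℕ (suc n) (λ i → f i * g (n ∸ i))

  oneS : Series
  oneS zero    = 1#
  oneS (suc _) = 0#

  _^S_ : Series → ℕ → Series
  f ^S zero  = oneS
  f ^S suc k = (f ^S k) ⊛ f

  polySeries : ∀ d → (Fin (suc d) → Carrier) → Series
  polySeries d a n with n ≤? d
  ... | yes n≤d = a (fromℕ< (s≤s n≤d))
  ... | no  _   = 0#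

  tpSeries : ∀ d → (Fin (suc d) → Carrier) → Series
  tpSeries d a zero    = 0#
  tpSeries d a (suc n) = polySeries d a n

  -- 1 / (1 - t^{d+1}) = sum_j t^{j(d+1)}
  geomSeries : ℕ → Series
  geomSeries d n with n % suc d ≟ 0
  ... | yes _ = 1#
  ... | no  _ = 0#

  -- Entry in row n, column k of the Riordan array (1/(1-t^{d+1}), t p(t)):
  -- the coefficient of t^n in (t p(t))^k / (1 - t^{d+1}).
  riordan : ∀ d → (Fin (suc d) → Carrier) → (n k : ℕ) → Carrier
  riordan d a n k = (geomSeries d ⊛ (tpSeries d a ^S k)) n

  -- Vectors of length d+1, written (x_d, x_{d-1}, ..., x_0): position j (0-based)
  -- is the j-th listed entry.
  -- T(x_d, ..., x_1, x_0) = (x_0, x_d, ..., x_1): cyclic shift to the right.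
  T : ∀ {d} → (Fin (suc d) → Carrier) → (Fin (suc d) → Carrier)
  T {d} x zero    = x (fromℕ d)
  T {d} x (suc j) = x (inject₁ j)

  iter : ∀ {A : Set c} → ℕ → (A → A) → A → A
  iter zero    f x = x
  iter (suc n) f x = f (iter n f x)

  revCoeffs : ∀ d → (Fin (suc d) → Carrier) → (Fin (suc d) → Carrier)
  revCoeffs d a j = a (opposite j)

  Vmat : ∀ d → (Fin (suc d) → Carrier) → Fin (suc d) → Fin (suc d) → Carrier
  Vmat d a i = iter (toℕ i) T (revCoeffs d a)

  matVec : ∀ {m n} → (Fin m → Fin n → Carrier) → (Fin n → Carrier) → (Fin m → Carrier)
  matVec M v i = sumFin (λ j → M i j * v j)

{-# OPTIONS --safe #-}
module Submission where

-- Since 1/(1 - t^{d+1}) = 1 + t^{d+1}/(1 - t^{d+1}), each column geom·(t p)^k of the array is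
-- (d+1)-periodic from row k(d+1) on, beyond the degree of (t p)^k.  Multiplying column k by t p(t)
-- makes every entry of column k+1 a combination of d+1 consecutive entries of column k with weights
-- a_d, …, a_0; in the periodic region this is a cyclic convolution, i.e. multiplication by the
-- circulant V.  Column 1 holds a_0, …, a_d in rows d+2, …, 2d+2, so by induction the rows
-- (n+1)(d+1)+1, …, (n+1)(d+1)+d+1 of column n+1 hold V^n a.

open import Defs
open import Algebra.Bundles using (CommutativeRing)
open import Data.Nat using (ℕ; zero; suc; _+_; _*_; _∸_; _%_; _≤_; _<_; z≤n; s≤s; _≤?_; _<?_; _≟_)
open import Data.Fin using (Fin; zero; suc; fromℕ; toℕ; inject₁; opposite)
open import Data.Product using (∃; _,_)
open import Relation.Nullary using (¬_; yes; no)
import Data.Nat.Properties as ℕₚ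
open import Data.Nat.DivMod using ([m+n]%n≡m%n; [m+kn]%n≡m%n; m<n⇒m%n≡m)
open import Data.Nat.Tactic.RingSolver using (solve-∀)
open import Data.Fin.Properties using (toℕ<n; toℕ-fromℕ; toℕ-inject₁; fromℕ<-toℕ; opposite-prop)
open import Data.Empty using (⊥-elim)
open import Relation.Binary.PropositionalEquality as ≡ using (_≡_)
import Algebra.Properties.CommutativeSemigroup as CommutativeSemigroupProperties
import Algebra.Properties.Group as GroupProperties
import Relation.Binary.Reasoning.Setoid as SetoidReasoning

module _ {c ℓ} (R : CommutativeRing c ℓ) where
  open CommutativeRing R using
    ( Carrier; _≈_; 0#; 1#; refl; sym; trans; reflexive; setoid
    ; +-cong; +-assoc; +-comm; +-identityˡ; +-identityʳ
    ; *-cong; *-assoc; *-comm; *-identityˡ; distribˡ; zeroˡ; zeroʳ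
    ; +-commutativeSemigroup; +-group )
    renaming (_+_ to _⊕_; _*_ to _⊗_)
  open SetoidReasoning setoid
  open CommutativeSemigroupProperties +-commutativeSemigroup using (interchange)
  open GroupProperties +-group using (∙-cancelʳ)

  sumℕ-cong : ∀ l {f g : ℕ → Carrier} → (∀ i → i < l → f i ≈ g i) → sumℕ R l f ≈ sumℕ R l g
  sumℕ-cong zero    f≈g = refl
  sumℕ-cong (suc l) f≈g =
    +-cong (sumℕ-cong l (λ i i<l → f≈g i (ℕₚ.m<n⇒m<1+n i<l))) (f≈g l (ℕₚ.n<1+n l))

  sumℕ-zero : ∀ l {f : ℕ → Carrier} → (∀ i → i < l → f i ≈ 0#) → sumℕ R l f ≈ 0#
  sumℕ-zero zero    f≈0 = refl
  sumℕ-zero (suc l) f≈0 = trans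
    (+-cong (sumℕ-zero l (λ i i<l → f≈0 i (ℕₚ.m<n⇒m<1+n i<l))) (f≈0 l (ℕₚ.n<1+n l)))
    (+-identityˡ 0#)

  sumℕ-distrib-+ : ∀ l (f g : ℕ → Carrier) →
                   sumℕ R l (λ i → f i ⊕ g i) ≈ sumℕ R l f ⊕ sumℕ R l g
  sumℕ-distrib-+ zero    f g = sym (+-identityˡ 0#)
  sumℕ-distrib-+ (suc l) f g = trans (+-cong (sumℕ-distrib-+ l f g) refl) (interchange _ _ _ _)

  *-distribˡ-sumℕ : ∀ l x (f : ℕ → Carrier) → x ⊗ sumℕ R l f ≈ sumℕ R l (λ i → x ⊗ f i)
  *-distribˡ-sumℕ zero    x f = zeroʳ x
  *-distribˡ-sumℕ (suc l) x f = trans (distribˡ x _ _) (+-cong (*-distribˡ-sumℕ l x f) refl)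

  *-distribʳ-sumℕ : ∀ l x (f : ℕ → Carrier) → sumℕ R l f ⊗ x ≈ sumℕ R l (λ i → f i ⊗ x)
  *-distribʳ-sumℕ l x f = begin
    sumℕ R l f ⊗ x               ≈⟨ *-comm _ x ⟩
    x ⊗ sumℕ R l f               ≈⟨ *-distribˡ-sumℕ l x f ⟩
    sumℕ R l (λ i → x ⊗ f i)     ≈⟨ sumℕ-cong l (λ i _ → *-comm x (f i)) ⟩
    sumℕ R l (λ i → f i ⊗ x)     ∎

  sumℕ-suc : ∀ l (f : ℕ → Carrier) → sumℕ R (suc l) f ≈ f 0 ⊕ sumℕ R l (λ i → f (suc i))
  sumℕ-suc zero    f = +-comm 0# (f 0)
  sumℕ-suc (suc l) f = trans (+-cong (sumℕ-suc l f) refl) (+-assoc _ _ _)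

  sumℕ-+ : ∀ m l (f : ℕ → Carrier) →
           sumℕ R (m + l) f ≈ sumℕ R m f ⊕ sumℕ R l (λ t → f (m + t))
  sumℕ-+ m zero    f rewrite ℕₚ.+-identityʳ m = sym (+-identityʳ _)
  sumℕ-+ m (suc l) f rewrite ℕₚ.+-suc m l = trans (+-cong (sumℕ-+ m l f) refl) (+-assoc _ _ _)

  sumℕ-periodic : ∀ q (f : ℕ → Carrier) → (∀ y → f (y + q) ≈ f y) →
                  ∀ x → sumℕ R q (λ t → f (x + t)) ≈ sumℕ R q f
  sumℕ-periodic q f f-periodic zero    = refl
  sumℕ-periodic q f f-periodic (suc x) = trans (sym slide) (sumℕ-periodic q f f-periodic x)
    where
    window : ℕ → Carrier
    window z = sumℕ R q (λ t → f (z + t))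
    slide : window x ≈ window (suc x)
    slide = ∙-cancelʳ (f x) _ _ (begin
      window x ⊕ f x                           ≈⟨ +-cong refl (sym (f-periodic x)) ⟩
      window x ⊕ f (x + q)                     ≈⟨ sumℕ-suc q (λ t → f (x + t)) ⟩
      f (x + 0) ⊕ sumℕ R q (λ t → f (x + suc t))
        ≈⟨ +-cong (reflexive (≡.cong f (ℕₚ.+-identityʳ x)))
                  (sumℕ-cong q (λ t _ → reflexive (≡.cong f (ℕₚ.+-suc x t)))) ⟩
      f x ⊕ window (suc x)                     ≈⟨ +-comm _ _ ⟩
      window (suc x) ⊕ f x                     ∎)

  sumFin-toℕ : ∀ n (f : ℕ → Carrier) → sumFin R {n} (λ j → f (toℕ j)) ≈ sumℕ R n f
  sumFin-toℕ zero    f = refl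
  sumFin-toℕ (suc n) f = trans (+-cong refl (sumFin-toℕ n (λ i → f (suc i)))) (sym (sumℕ-suc n f))

  sumFin-cong : ∀ n {f g : Fin n → Carrier} → (∀ j → f j ≈ g j) → sumFin R f ≈ sumFin R g
  sumFin-cong zero    f≈g = refl
  sumFin-cong (suc n) f≈g = +-cong (f≈g zero) (sumFin-cong n (λ j → f≈g (suc j)))

  -- Summing F i j over the triangle i + j ≤ N by rows i or by diagonals i + j = m.
  sumℕ-triangle : ∀ (F : ℕ → ℕ → Carrier) N →
    sumℕ R (suc N) (λ i → sumℕ R (suc (N ∸ i)) (F i)) ≈
    sumℕ R (suc N) (λ m → sumℕ R (suc m) (λ i → F i (m ∸ i)))
  sumℕ-triangle F zero    = refl
  sumℕ-triangle F (suc N) = begin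
      sumℕ R (suc N) (λ i → sumℕ R (suc (suc N ∸ i)) (F i)) ⊕ sumℕ R (suc (N ∸ N)) (F (suc N))
    ≈⟨ +-cong (trans (sumℕ-cong (suc N) row-snoc) (sumℕ-distrib-+ (suc N) _ _)) last-row ⟩
      (sumℕ R (suc N) (λ i → sumℕ R (suc (N ∸ i)) (F i)) ⊕ diagonal) ⊕ F (suc N) 0
    ≈⟨ +-cong (+-cong (sumℕ-triangle F N) refl) refl ⟩
      (sumℕ R (suc N) (λ m → sumℕ R (suc m) (λ i → F i (m ∸ i))) ⊕ diagonal) ⊕ F (suc N) 0
    ≈⟨ +-assoc _ _ _ ⟩
      sumℕ R (suc N) (λ m → sumℕ R (suc m) (λ i → F i (m ∸ i))) ⊕ (diagonal ⊕ F (suc N) 0)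
    ≈⟨ +-cong refl (+-cong refl (reflexive (≡.cong (F (suc N)) (≡.sym (ℕₚ.n∸n≡0 N))))) ⟩
      sumℕ R (suc N) (λ m → sumℕ R (suc m) (λ i → F i (m ∸ i))) ⊕ (diagonal ⊕ F (suc N) (N ∸ N))
    ∎
    where
    diagonal : Carrier
    diagonal = sumℕ R (suc N) (λ i → F i (suc N ∸ i))
    row-snoc : ∀ i → i < suc N →
      sumℕ R (suc (suc N ∸ i)) (F i) ≈ sumℕ R (suc (N ∸ i)) (F i) ⊕ F i (suc N ∸ i)
    row-snoc i (s≤s i≤N) rewrite ℕₚ.+-∸-assoc 1 i≤N = refl
    last-row : sumℕ R (suc (N ∸ N)) (F (suc N)) ≈ F (suc N) 0
    last-row rewrite ℕₚ.n∸n≡0 N = +-identityˡ _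

  infixl 7 _⋆_
  _⋆_ : Series R → Series R → Series R
  _⋆_ = _⊛_ R

  ⋆-congʳ : ∀ f {g h : Series R} → (∀ i → g i ≈ h i) → ∀ n → (f ⋆ g) n ≈ (f ⋆ h) n
  ⋆-congʳ f g≈h n = sumℕ-cong (suc n) (λ i _ → *-cong refl (g≈h (n ∸ i)))

  ⋆-assoc : ∀ (f g h : Series R) n → (f ⋆ (g ⋆ h)) n ≈ ((f ⋆ g) ⋆ h) n
  ⋆-assoc f g h n = begin
      sumℕ R (suc n) (λ i → f i ⊗ sumℕ R (suc (n ∸ i)) (λ j → g j ⊗ h (n ∸ i ∸ j)))
    ≈⟨ sumℕ-cong (suc n) (λ i _ → *-distribˡ-sumℕ (suc (n ∸ i)) (f i) _) ⟩
      sumℕ R (suc n) (λ i → sumℕ R (suc (n ∸ i)) (λ j → f i ⊗ (g j ⊗ h (n ∸ i ∸ j))))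
    ≈⟨ sumℕ-triangle (λ i j → f i ⊗ (g j ⊗ h (n ∸ i ∸ j))) n ⟩
      sumℕ R (suc n) (λ m → sumℕ R (suc m) (λ i → f i ⊗ (g (m ∸ i) ⊗ h (n ∸ i ∸ (m ∸ i)))))
    ≈⟨ sumℕ-cong (suc n) (λ m _ → sumℕ-cong (suc m) (reassociate m)) ⟩
      sumℕ R (suc n) (λ m → sumℕ R (suc m) (λ i → (f i ⊗ g (m ∸ i)) ⊗ h (n ∸ m)))
    ≈⟨ sumℕ-cong (suc n) (λ m _ → sym (*-distribʳ-sumℕ (suc m) (h (n ∸ m)) _)) ⟩
      sumℕ R (suc n) (λ m → (f ⋆ g) m ⊗ h (n ∸ m))
    ∎
    where
    reassociate : ∀ m i → i < suc m →
      f i ⊗ (g (m ∸ i) ⊗ h (n ∸ i ∸ (m ∸ i))) ≈ (f i ⊗ g (m ∸ i)) ⊗ h (n ∸ m)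
    reassociate m i (s≤s i≤m) = trans (sym (*-assoc _ _ _)) (*-cong refl (reflexive (≡.cong h
      (≡.trans (ℕₚ.∸-+-assoc n i (m ∸ i)) (≡.cong (n ∸_) (ℕₚ.m+[n∸m]≡n i≤m))))))

  oneS-⋆ : ∀ (f : Series R) n → (oneS R ⋆ f) n ≈ f n
  oneS-⋆ f n = begin
    (oneS R ⋆ f) n                                   ≈⟨ sumℕ-suc n _ ⟩
    1# ⊗ f n ⊕ sumℕ R n (λ i → 0# ⊗ f (n ∸ suc i))
      ≈⟨ +-cong (*-identityˡ _) (sumℕ-zero n (λ i _ → zeroˡ _)) ⟩
    f n ⊕ 0#                                         ≈⟨ +-identityʳ _ ⟩
    f n                                              ∎

  DegreeAtMost : ℕ → Series R → Set ℓ
  DegreeAtMost m f = ∀ i → m < i → f i ≈ 0#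

  ⋆-degree : ∀ {m n} {f g : Series R} → DegreeAtMost m f → DegreeAtMost n g →
             DegreeAtMost (m + n) (f ⋆ g)
  ⋆-degree {m} {n} {f} {g} f≤m g≤n k m+n<k = sumℕ-zero (suc k) term
    where
    term : ∀ i → i < suc k → f i ⊗ g (k ∸ i) ≈ 0#
    term i _ with m <? i
    ... | yes m<i = trans (*-cong (f≤m i m<i) refl) (zeroˡ _)
    ... | no  m≮i = trans (*-cong refl (g≤n (k ∸ i) (ℕₚ.m+n≤o⇒m≤o∸n (suc n) n+i<k))) (zeroʳ _)
      where
      n+i<k : suc n + i ≤ k
      n+i<k = ℕₚ.≤-trans (s≤s (ℕₚ.≤-trans (ℕₚ.+-monoʳ-≤ n (ℕₚ.≮⇒≥ m≮i))
                                          (ℕₚ.≤-reflexive (ℕₚ.+-comm n m)))) m+n<k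

  ^S-degree : ∀ {m} {f : Series R} → DegreeAtMost m f → ∀ k → DegreeAtMost (k * m) (_^S_ R f k)
  ^S-degree f≤m zero    (suc i) _ = refl
  ^S-degree {m} {f} f≤m (suc k) = ≡.subst (λ e → DegreeAtMost e (_^S_ R f (suc k))) (ℕₚ.+-comm (k * m) m)
                                      (⋆-degree (^S-degree f≤m k) f≤m)

  module _ (d : ℕ) where
    private
      geom : Series R
      geom = geomSeries R d

    geomSeries-≡-mod : ∀ x y → x % suc d ≡ y % suc d → geom x ≡ geom y
    geomSeries-≡-mod x y x≡y with x % suc d ≟ 0 | y % suc d ≟ 0
    ... | yes _   | yes _   = ≡.refl
    ... | no  _   | no  _   = ≡.refl
    ... | yes x≡0 | no  y≢0 = ⊥-elim (y≢0 (≡.trans (≡.sym x≡y) x≡0))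
    ... | no  x≢0 | yes y≡0 = ⊥-elim (x≢0 (≡.trans x≡y y≡0))

    geomSeries-periodic : ∀ n → geom (suc d + n) ≡ geom n
    geomSeries-periodic n = geomSeries-≡-mod (suc d + n) n
      (≡.trans (≡.cong (_% suc d) (ℕₚ.+-comm (suc d) n)) ([m+n]%n≡m%n n (suc d)))

    geomSeries-gap : ∀ i → 0 < i → i < suc d → geom i ≡ 0#
    geomSeries-gap i 0<i i<d+1 with i % suc d ≟ 0
    ... | yes i%≡0 = ⊥-elim (ℕₚ.<⇒≢ 0<i (≡.sym (≡.trans (≡.sym (m<n⇒m%n≡m i<d+1)) i%≡0)))
    ... | no  _    = ≡.refl

    -- 1/(1 - t^{d+1}) = 1 + t^{d+1}/(1 - t^{d+1})
    geom⋆-shift : ∀ (Q : Series R) n → (geom ⋆ Q) (suc d + n) ≈ Q (suc d + n) ⊕ (geom ⋆ Q) n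
    geom⋆-shift Q n = begin
        sumℕ R (suc (suc d + n)) h
      ≈⟨ reflexive (≡.cong (λ m → sumℕ R m h) (≡.sym (ℕₚ.+-suc (suc d) n))) ⟩
        sumℕ R (suc d + suc n) h
      ≈⟨ sumℕ-+ (suc d) (suc n) h ⟩
        sumℕ R (suc d) h ⊕ sumℕ R (suc n) (λ t → h (suc d + t))
      ≈⟨ +-cong head tail ⟩
        Q (suc d + n) ⊕ (geom ⋆ Q) n
      ∎
      where
      h : ℕ → Carrier
      h i = geom i ⊗ Q (suc d + n ∸ i)
      head : sumℕ R (suc d) h ≈ Q (suc d + n)
      head = begin
        sumℕ R (suc d) h                  ≈⟨ sumℕ-suc d h ⟩
        h 0 ⊕ sumℕ R d (λ i → h (suc i))
          ≈⟨ +-cong (*-identityˡ _) (sumℕ-zero d (λ i i<d →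
               trans (*-cong (reflexive (geomSeries-gap (suc i) (s≤s z≤n) (s≤s i<d))) refl) (zeroˡ _))) ⟩
        Q (suc d + n) ⊕ 0#                ≈⟨ +-identityʳ _ ⟩
        Q (suc d + n)                     ∎
      tail : sumℕ R (suc n) (λ t → h (suc d + t)) ≈ (geom ⋆ Q) n
      tail = sumℕ-cong (suc n) (λ t _ → *-cong (reflexive (geomSeries-periodic t))
                                                 (reflexive (≡.cong Q (ℕₚ.[m+n]∸[m+o]≡n∸o (suc d) n t))))

    geom⋆-periodic : ∀ {m} {Q : Series R} → DegreeAtMost m Q →
                     ∀ n → m < suc d + n → (geom ⋆ Q) (suc d + n) ≈ (geom ⋆ Q) n
    geom⋆-periodic {Q = Q} Q≤m n m<d+1+n = begin
      (geom ⋆ Q) (suc d + n)             ≈⟨ geom⋆-shift Q n ⟩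
      Q (suc d + n) ⊕ (geom ⋆ Q) n       ≈⟨ +-cong (Q≤m (suc d + n) m<d+1+n) refl ⟩
      0# ⊕ (geom ⋆ Q) n                  ≈⟨ +-identityˡ _ ⟩
      (geom ⋆ Q) n                       ∎

    geom⋆-initial : ∀ (Q : Series R) y → y ≤ suc d → Q 0 ≈ 0# → (geom ⋆ Q) y ≈ Q y
    geom⋆-initial Q y y≤d+1 Q0≈0 = begin
      (geom ⋆ Q) y                                              ≈⟨ sumℕ-suc y _ ⟩
      1# ⊗ Q y ⊕ sumℕ R y (λ i → geom (suc i) ⊗ Q (y ∸ suc i))
        ≈⟨ +-cong (*-identityˡ _) (sumℕ-zero y term) ⟩
      Q y ⊕ 0#                                                  ≈⟨ +-identityʳ _ ⟩
      Q y                                                       ∎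
      where
      term : ∀ i → i < y → geom (suc i) ⊗ Q (y ∸ suc i) ≈ 0#
      term i i<y with suc i ≟ y
      ... | yes ≡.refl = trans (*-cong refl (trans (reflexive (≡.cong Q (ℕₚ.n∸n≡0 i))) Q0≈0)) (zeroʳ _)
      ... | no  i+1≢y  = trans (*-cong (reflexive (geomSeries-gap (suc i) (s≤s z≤n)
                                 (ℕₚ.<-≤-trans (ℕₚ.≤∧≢⇒< i<y i+1≢y) y≤d+1))) refl) (zeroˡ _)

  Window : ∀ {d} → (ℕ → Carrier) → ℕ → (Fin (suc d) → Carrier) → Set ℓ
  Window f c x = ∀ j → x j ≈ f (c + toℕ j)

  module _ {d : ℕ} (f : ℕ → Carrier) (f-periodic : ∀ y → f (y + suc d) ≈ f y) where

    -- Modulo the period, c + d ≡ c - 1: rotating right moves the window back by one.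
    T-window : ∀ {c} {x : Fin (suc d) → Carrier} → Window f c x → Window f (c + d) (T R x)
    T-window {c} x≈f zero    = trans (x≈f (fromℕ d))
      (reflexive (≡.cong f (≡.trans (≡.cong (c +_) (toℕ-fromℕ d)) (≡.sym (ℕₚ.+-identityʳ (c + d))))))
    T-window {c} {x} x≈f (suc j) = begin
      x (inject₁ j)              ≈⟨ x≈f (inject₁ j) ⟩
      f (c + toℕ (inject₁ j))    ≡⟨ ≡.cong (λ z → f (c + z)) (toℕ-inject₁ j) ⟩
      f (c + toℕ j)              ≈⟨ sym (f-periodic (c + toℕ j)) ⟩
      f (c + toℕ j + suc d)      ≡⟨ ≡.cong f (rearrange c d (toℕ j)) ⟩
      f (c + d + suc (toℕ j))    ∎
      where
      rearrange : ∀ c d j → c + j + suc d ≡ c + d + suc j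
      rearrange = solve-∀

    iter-T-window : ∀ {c} {x : Fin (suc d) → Carrier} → Window f c x →
                    ∀ m → Window f (c + m * d) (iter R m (T R) x)
    iter-T-window {c} {x} x≈f zero    = ≡.subst (λ e → Window f e x) (≡.sym (ℕₚ.+-identityʳ c)) x≈f
    iter-T-window {c} {x} x≈f (suc m) = ≡.subst (λ e → Window f e (iter R (suc m) (T R) x))
      (≡.trans (ℕₚ.+-assoc c (m * d) d) (≡.cong (c +_) (ℕₚ.+-comm (m * d) d)))
      (T-window (iter-T-window x≈f m))

  module _ (d : ℕ) (a : Fin (suc d) → Carrier) where
    private
      p tp : Series R
      p  = polySeries R d a
      tp = tpSeries R d a

    polySeries-toℕ : ∀ x → p (toℕ x) ≡ a x
    polySeries-toℕ x with toℕ x ≤? d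
    ... | yes x≤d = ≡.cong a (fromℕ<-toℕ x (s≤s x≤d))
    ... | no  x≰d = ⊥-elim (x≰d (ℕₚ.≤-pred (toℕ<n x)))

    polySeries-degree : DegreeAtMost d p
    polySeries-degree i d<i with i ≤? d
    ... | yes i≤d = ⊥-elim (ℕₚ.<⇒≱ d<i i≤d)
    ... | no  _   = refl

    tpSeries-degree : DegreeAtMost (suc d) tp
    tpSeries-degree (suc i) (s≤s d<i) = polySeries-degree i d<i

    ⋆-tpSeries : ∀ (Q : Series R) e →
                 (Q ⋆ tp) (e + suc d) ≈ sumℕ R (suc d) (λ t → Q (e + t) ⊗ p (d ∸ t))
    ⋆-tpSeries Q e = begin
        sumℕ R (suc (e + suc d)) h
      ≈⟨ reflexive (≡.cong (λ m → sumℕ R m h) (≡.sym (ℕₚ.+-suc e (suc d)))) ⟩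
        sumℕ R (e + suc (suc d)) h
      ≈⟨ sumℕ-+ e (suc (suc d)) h ⟩
        sumℕ R e h ⊕ (sumℕ R (suc d) (λ t → h (e + t)) ⊕ h (e + suc d))
      ≈⟨ +-cong (sumℕ-zero e below) (+-cong (sumℕ-cong (suc d) window) at-end) ⟩
        0# ⊕ (sumℕ R (suc d) (λ t → Q (e + t) ⊗ p (d ∸ t)) ⊕ 0#)
      ≈⟨ trans (+-identityˡ _) (+-identityʳ _) ⟩
        sumℕ R (suc d) (λ t → Q (e + t) ⊗ p (d ∸ t))
      ∎
      where
      h : ℕ → Carrier
      h s = Q s ⊗ tp (e + suc d ∸ s)
      below : ∀ s → s < e → h s ≈ 0#
      below s s<e = trans (*-cong refl (tpSeries-degree _ d+1<e+d+1∸s)) (zeroʳ _)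
        where
        d+1<e+d+1∸s : suc d < e + suc d ∸ s
        d+1<e+d+1∸s = ≡.subst (_< e + suc d ∸ s) (ℕₚ.m+n∸m≡n s (suc d))
          (ℕₚ.∸-monoˡ-< (ℕₚ.+-monoˡ-< (suc d) s<e) (ℕₚ.m≤m+n s (suc d)))
      window : ∀ t → t < suc d → h (e + t) ≈ Q (e + t) ⊗ p (d ∸ t)
      window t (s≤s t≤d) = *-cong refl (reflexive (≡.cong tp
        (≡.trans (ℕₚ.[m+n]∸[m+o]≡n∸o e (suc d) t) (ℕₚ.+-∸-assoc 1 t≤d))))
      at-end : h (e + suc d) ≈ 0#
      at-end = trans (*-cong refl (reflexive (≡.cong tp (ℕₚ.n∸n≡0 (e + suc d))))) (zeroʳ _)

    riordan-periodic : ∀ k n → k * suc d < suc d + n →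
                       riordan R d a (suc d + n) k ≈ riordan R d a n k
    riordan-periodic k = geom⋆-periodic d (^S-degree tpSeries-degree k)

    riordan-suc : ∀ k e → riordan R d a (e + suc d) (suc k) ≈
                          sumℕ R (suc d) (λ t → riordan R d a (e + t) k ⊗ p (d ∸ t))
    riordan-suc k e = trans (⋆-assoc (geomSeries R d) (_^S_ R tp k) tp (e + suc d)) (⋆-tpSeries _ e)

    riordan-column₁ : ∀ (j : Fin (suc d)) → riordan R d a (suc d + suc (toℕ j)) 1 ≈ a j
    riordan-column₁ j = begin
      riordan R d a (suc d + suc (toℕ j)) 1
        ≈⟨ riordan-periodic 1 (suc (toℕ j)) (ℕₚ.+-monoʳ-< (suc d) (s≤s z≤n)) ⟩
      riordan R d a (suc (toℕ j)) 1
        ≈⟨ ⋆-congʳ (geomSeries R d) (oneS-⋆ tp) (suc (toℕ j)) ⟩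
      (geomSeries R d ⋆ tp) (suc (toℕ j))
        ≈⟨ geom⋆-initial d tp (suc (toℕ j)) (toℕ<n j) refl ⟩
      p (toℕ j)
        ≡⟨ polySeries-toℕ j ⟩
      a j
        ∎

    -- circulant y = a_{d - (y mod (d+1))}; since i d ≡ -i modulo d + 1, entry (i, j) of V is circulant (i d + j).
    circulant : ℕ → Carrier
    circulant y = p (d ∸ y % suc d)

    circulant-periodic : ∀ y → circulant (y + suc d) ≡ circulant y
    circulant-periodic y = ≡.cong (λ z → p (d ∸ z)) ([m+n]%n≡m%n y (suc d))

    circulant-diagonal : ∀ i t → t < suc d → circulant (i * d + (i + t)) ≡ p (d ∸ t)
    circulant-diagonal i t t<d+1 = ≡.cong (λ z → p (d ∸ z))
      (≡.trans (≡.cong (_% suc d) (rearrange i d t))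
      (≡.trans ([m+kn]%n≡m%n t i (suc d)) (m<n⇒m%n≡m t<d+1)))
      where
      rearrange : ∀ i d t → i * d + (i + t) ≡ t + i * suc d
      rearrange = solve-∀

    revCoeffs-window : Window circulant 0 (revCoeffs R d a)
    revCoeffs-window j = reflexive (≡.trans (≡.sym (polySeries-toℕ (opposite j)))
      (≡.cong p (≡.trans (opposite-prop j) (≡.cong (d ∸_) (≡.sym (m<n⇒m%n≡m (toℕ<n j)))))))

    Vmat-circulant : ∀ i j → Vmat R d a i j ≈ circulant (toℕ i * d + toℕ j)
    Vmat-circulant i =
      iter-T-window circulant (λ y → reflexive (circulant-periodic y)) {c = 0} revCoeffs-window (toℕ i)

    riordan-block-periodic : ∀ n y →
      riordan R d a (suc (suc n * suc d) + (y + suc d)) (suc n) ≈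
      riordan R d a (suc (suc n * suc d) + y) (suc n)
    riordan-block-periodic n y = trans
      (reflexive (≡.cong (λ m → riordan R d a m (suc n)) (rearrange (suc (suc n * suc d)) y d)))
      (riordan-periodic (suc n) _ (ℕₚ.≤-trans (ℕₚ.m≤m+n _ y) (ℕₚ.m≤n+m _ (suc d))))
      where
      rearrange : ∀ s y d → s + (y + suc d) ≡ suc d + (s + y)
      rearrange = solve-∀

    riordan-block : ∀ n (j : Fin (suc d)) →
      riordan R d a (suc (suc n * suc d) + toℕ j) (suc n) ≈ iter R n (matVec R (Vmat R d a)) a j
    riordan-block zero    j =
      trans (reflexive (≡.cong (λ m → riordan R d a m 1) (rearrange d (toℕ j)))) (riordan-column₁ j)
      where
      rearrange : ∀ d j → suc (suc d + 0) + j ≡ suc d + suc j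
      rearrange = solve-∀
    riordan-block (suc n) j = begin
        riordan R d a (suc (suc (suc n) * suc d) + toℕ j) (suc (suc n))
      ≡⟨ ≡.cong (λ m → riordan R d a m (suc (suc n))) (rearrange n d (toℕ j)) ⟩
        riordan R d a (row + toℕ j + suc d) (suc (suc n))
      ≈⟨ riordan-suc (suc n) (row + toℕ j) ⟩
        sumℕ R (suc d) (λ t → riordan R d a (row + toℕ j + t) (suc n) ⊗ p (d ∸ t))
      ≈⟨ sumℕ-cong (suc d) as-summand ⟩
        sumℕ R (suc d) (λ t → summand (toℕ j + t))
      ≈⟨ sumℕ-periodic (suc d) summand summand-periodic (toℕ j) ⟩
        sumℕ R (suc d) summand
      ≈⟨ sym (sumFin-toℕ (suc d) summand) ⟩
        sumFin R {suc d} (λ j′ → summand (toℕ j′))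
      ≈⟨ sumFin-cong (suc d) (λ j′ → *-cong (sym (Vmat-circulant j j′)) (riordan-block n j′)) ⟩
        iter R (suc n) (matVec R (Vmat R d a)) a j
      ∎
      where
      row : ℕ
      row = suc (suc n * suc d)
      rearrange : ∀ n d j → suc (suc (suc n) * suc d) + j ≡ suc (suc n * suc d) + j + suc d
      rearrange = solve-∀
      summand : ℕ → Carrier
      summand y = circulant (toℕ j * d + y) ⊗ riordan R d a (row + y) (suc n)
      as-summand : ∀ t → t < suc d →
                   riordan R d a (row + toℕ j + t) (suc n) ⊗ p (d ∸ t) ≈ summand (toℕ j + t)
      as-summand t t<d+1 = trans (*-comm _ _) (*-cong
        (reflexive (≡.sym (circulant-diagonal (toℕ j) t t<d+1)))
        (reflexive (≡.cong (λ m → riordan R d a m (suc n)) (ℕₚ.+-assoc row (toℕ j) t))))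
      summand-periodic : ∀ y → summand (y + suc d) ≈ summand y
      summand-periodic y = *-cong
        (reflexive (≡.trans (≡.cong circulant (≡.sym (ℕₚ.+-assoc (toℕ j * d) y (suc d))))
                            (circulant-periodic (toℕ j * d + y))))
        (riordan-block-periodic n y)

corollary3 : ∀ {c ℓ} (R : CommutativeRing c ℓ) → IsIntegralDomain R →
    (d : ℕ) (a : Fin (ℕ.suc d) → CommutativeRing.Carrier R) →
    ¬ CommutativeRing._≈_ R (a (fromℕ d)) (CommutativeRing.0# R) →
    ¬ CommutativeRing._≈_ R (a zero) (CommutativeRing.0# R) →
    (n : ℕ) → ∃ λ k → ∃ λ r → (j : Fin (ℕ.suc d)) →
    CommutativeRing._≈_ R (riordan R d a (r + toℕ j) k)
    (iter R n (matVec R (Vmat R d a)) a j)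
corollary3 R _ d a _ _ n = suc n , suc (suc n * suc d) , riordan-block R d a n
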